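{- Let $\phi$ be a CNF formula, let $\{X,Y\}$ be a partition of $\mathrm{vars}(\phi)$, let $(T,r,\gamma,\pi)$ be an $(X,Y)$-graded project-join tree for $\phi$ with grades $\mathcal{I}_X,\mathcal{I}_Y$, and let $\mathrm{pr}:Y\to[0,1]$ be a probability mapping. Then the $\mathrm{pr}$-valuation of the root satisfies $$\mathrm{val}(r)(\emptyset)=\big(\exists_X\,\mathcal{R}^{\mathrm{pr}}_Y\,[\phi]\big)(\emptyset).$$
   Context: Variables are binary and $\mathbb{B}=\{0,1\}$. $2^S$ is the set of truth assignments $S\to\mathbb{B}$. A pseudo-Boolean (PB) function over $X$ is a map $f:2^X\to\mathbb{R}$. Join: $(f\cdot g)(\tau)=f(\tau|_X)\,g(\tau|_Y)$ for $f$ over $X$, $g$ over $Y$, and $\tau\in 2^{X\cup Y}$. Existential projection: $(\exists_x f)(\tau)=\max(f(\tau\cup\{x\mapsto0\}),f(\tau\cup\{x\mapsto1\}))$. Random projection: $(\mathcal{R}^p_x f)(\tau)=p f(\tau\cup\{x\mapsto1\})+(1-p)f(\tau\cup\{x\mapsto0\})$. For a set $S$, $\exists_S$ and $\mathcal{R}^{\mathrm{pr}}_S$ apply these operations for every $x\in S$, using probability $\mathrm{pr}(x)$ for $\mathcal{R}$. Both are order-independent and are the identity when $S=\emptyset$. A CNF formula $\phi$ is a set of clauses; $[\psi]$ is the 0/1-valued function of a formula $\psi$, and $[\phi]=\prod_{c\in\phi}[c]$. In a rooted tree $(T,r)$, $C(v)$ denotes the children of $v$. Leaves are non-root nodes of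 degree one; the other nodes are internal. A project-join tree for $\phi$ is $(T,r,\gamma,\pi)$ where: - $\gamma$ is a bijection from the leaves to the clauses of $\phi$; - $\pi$ maps internal nodes to subsets of $\mathrm{vars}(\phi)$; - $\{\pi(v)\}$ partitions $\mathrm{vars}(\phi)$, where some $\pi(v)$ may be empty; - for internal $v$, $x\in\pi(v)$ and a clause $c$ containing $x$, the leaf $\gamma^{ -1}(c)$ is a descendant of $v$. It is $(X,Y)$-graded with grades $\mathcal{I}_X,\mathcal{I}_Y$ if: - $\{\mathcal{I}_X,\mathcal{I}_Y\}$ partitions the internal nodes; - $\pi(v)\subseteq X$ for $v\in\mathcal{I}_X$; - $\pi(v)\subseteq Y$ for $v\in\mathcal{I}_Y$; - no node of $\mathcal{I}_X$ is a descendant of a node of $\mathcal{I}_Y$. The $\mathrm{pr}$-valuation of a node $v$ is defined recursively: - $\mathrm{val}(v)=[\gamma(v)]$ if $v$ is a leaf; - $\mathrm{val}(v)=\exists_{\pi(v)}\prod_{v'\in C(v)}\mathrm{val}(v')$ if $v\in\mathcal{I}_X$; - $\mathrm{val}(v)=\mathcal{R}^{\mathrm{pr}}_{\pi(v)}\prod_{v'\in C(v)}\mathrm{val}(v')$ if $v\in\mathcal{I}_Y$.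
   Formalization: The probability mapping pr and the pseudo-Boolean functions take rational values rather than real ones. -}

module Defs where

open import Data.Nat using (ℕ; _≟_)
open import Relation.Nullary using (yes; no)
open import Data.Unit using (⊤)
open import Data.Empty using (⊥)
open import Data.Sum using (_⊎_)
open import Data.Bool using (Bool; true; false; if_then_else_; not; _∨_)
open import Data.Product using (_×_; _,_; proj₁)
open import Data.List using (List; []; _∷_; map; concatMap; length; lookup; foldr; _++_; allFin)
open import Data.List.Membership.Propositional using (_∈_)
open import Data.List.Relation.Unary.All using (All)
open import Data.List.Relation.Unary.Unique.Propositional using (Unique)
open import Data.List.Relation.Binary.Permutation.Propositional using (_↭_)
open import Data.Fin using (Fin)
open import Data.Rational using (ℚ; 0ℚ; 1ℚ; _+_; _*_; _-_; _⊔_; _≤_)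
open import Relation.Binary.PropositionalEquality using (_≡_)
open import Function.Bundles using (_⇔_)

Var : Set
Var = ℕ

-- a literal is a variable together with its polarity (true = positive)
Literal : Set
Literal = Var × Bool

Clause : Set
Clause = List Literal

-- a CNF formula: its clauses, listed (a set of clauses = duplicate-free list)
CNF : Set
CNF = List Clause

clauseVars : Clause → List Var
clauseVars = map proj₁

vars : CNF → List Var
vars = concatMap clauseVars

-- Assignments are total maps Var → Bool; a PB function over X is
-- represented as a function of total assignments (which only depends
-- on the variables in X).

Assignment : Set
Assignment = Var → Bool

PB : Set
PB = Assignment → ℚ

-- the empty assignment (every variable has been projected away, so the
-- choice of the default value is immaterial)
∅ : Assignment
∅ _ = false

_[_↦_] : Assignment → Var → Bool → Assignment
(τ [ x ↦ b ]) y with y ≟ x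
... | yes _ = b
... | no  _ = τ y

⟦_⟧𝔹 : Bool → ℚ
⟦ true ⟧𝔹 = 1ℚ
⟦ false ⟧𝔹 = 0ℚ

litSat : Assignment → Literal → Bool
litSat τ (x , true) = τ x
litSat τ (x , false) = not (τ x)

clauseSat : Assignment → Clause → Bool
clauseSat τ [] = false
clauseSat τ (l ∷ c) = litSat τ l ∨ clauseSat τ c

⟦_⟧ᶜ : Clause → PB
⟦ c ⟧ᶜ τ = ⟦ clauseSat τ c ⟧𝔹

_·_ : PB → PB → PB
(f · g) τ = f τ * g τ

one : PB
one _ = 1ℚ

joinAll : List PB → PB
joinAll = foldr _·_ one

⟦_⟧ : CNF → PB
⟦ φ ⟧ = joinAll (map ⟦_⟧ᶜ φ)

∃₁ : Var → PB → PB
∃₁ x f τ = f (τ [ x ↦ false ]) ⊔ f (τ [ x ↦ true ])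

R₁ : ℚ → Var → PB → PB
R₁ p x f τ = p * f (τ [ x ↦ true ]) + (1ℚ - p) * f (τ [ x ↦ false ])

∃ₛ : List Var → PB → PB
∃ₛ S f = foldr ∃₁ f S

Rₛ : (Var → ℚ) → List Var → PB → PB
Rₛ pr S f = foldr (λ x g → R₁ (pr x) x g) f S

-- Rooted trees for a formula with m clauses.
-- A leaf carries γ(leaf) as a clause index; an internal node carries its
-- grade (X or Y), its label π(v) and its list of children.

data Grade : Set where
  gX gY : Grade

data Tree (m : ℕ) : Set where
  leaf : Fin m → Tree m
  node : Grade → List Var → List (Tree m) → Tree m

leaves : ∀ {m} → Tree m → List (Fin m)
leavesF : ∀ {m} → List (Tree m) → List (Fin m)
leaves (leaf i) = i ∷ []
leaves (node _ _ ts) = leavesF ts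
leavesF [] = []
leavesF (t ∷ ts) = leaves t ++ leavesF ts

labels : ∀ {m} → Tree m → List Var
labelsF : ∀ {m} → List (Tree m) → List Var
labels (leaf _) = []
labels (node _ xs ts) = xs ++ labelsF ts
labelsF [] = []
labelsF (t ∷ ts) = labels t ++ labelsF ts

-- Every non-root internal node has at least one child (a non-root node
-- of degree one is a leaf).  The root may have any number of children.
data NonEmpty {A : Set} : List A → Set where
  nonEmpty : ∀ {a as} → NonEmpty (a ∷ as)

NonRootOK : ∀ {m} → Tree m → Set
NonRootOKF : ∀ {m} → List (Tree m) → Set
NonRootOK (leaf _) = ⊤
NonRootOK (node _ _ ts) = NonEmpty ts × NonRootOKF ts
NonRootOKF [] = ⊤
NonRootOKF (t ∷ ts) = NonRootOK t × NonRootOKF ts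

RootOK : ∀ {m} → Tree m → Set
RootOK (leaf _) = ⊥
RootOK (node _ _ ts) = NonRootOKF ts

Scoped : ∀ {m} → (Fin m → Clause) → Tree m → Set
ScopedF : ∀ {m} → (Fin m → Clause) → List (Tree m) → Set
Scoped cl (leaf _) = ⊤
Scoped cl (node _ xs ts) =
  (∀ x i → x ∈ xs → x ∈ clauseVars (cl i) → i ∈ leavesF ts)
  × ScopedF cl ts
ScopedF cl [] = ⊤
ScopedF cl (t ∷ ts) = Scoped cl t × ScopedF cl ts

record IsPJTree (φ : CNF) (t : Tree (length φ)) : Set where
  field
    rooted     : RootOK t
    γ-bij      : leaves t ↭ allFin (length φ)
    π-disjoint : Unique (labels t)
    π-covers   : ∀ x → (x ∈ labels t ⇔ x ∈ vars φ)
    scoped     : Scoped (lookup φ) t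

OnlyY : ∀ {m} → Tree m → Set
OnlyYF : ∀ {m} → List (Tree m) → Set
OnlyY (leaf _) = ⊤
OnlyY (node gX _ _) = ⊥
OnlyY (node gY _ ts) = OnlyYF ts
OnlyYF [] = ⊤
OnlyYF (t ∷ ts) = OnlyY t × OnlyYF ts

Graded : ∀ {m} → List Var → List Var → Tree m → Set
GradedF : ∀ {m} → List Var → List Var → List (Tree m) → Set
Graded X Y (leaf _) = ⊤
Graded X Y (node gX xs ts) = (∀ x → x ∈ xs → x ∈ X) × GradedF X Y ts
Graded X Y (node gY xs ts) = (∀ x → x ∈ xs → x ∈ Y) × GradedF X Y ts × OnlyYF ts
GradedF X Y [] = ⊤
GradedF X Y (t ∷ ts) = Graded X Y t × GradedF X Y ts

val : ∀ {m} → (Fin m → Clause) → (Var → ℚ) → Tree m → PB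
valF : ∀ {m} → (Fin m → Clause) → (Var → ℚ) → List (Tree m) → PB
val cl pr (leaf i) = ⟦ cl i ⟧ᶜ
val cl pr (node gX xs ts) = ∃ₛ xs (valF cl pr ts)
val cl pr (node gY xs ts) = Rₛ pr xs (valF cl pr ts)
valF cl pr [] = one
valF cl pr (t ∷ ts) = val cl pr t · valF cl pr ts

record IsPartition (φ : CNF) (X Y : List Var) : Set where
  field
    disjoint : ∀ x → x ∈ X → x ∈ Y → ⊥
    covers   : ∀ x → ((x ∈ X ⊎ x ∈ Y) ⇔ x ∈ vars φ)

-- By induction on the tree, the valuation of a node v is ∃_{X_v} R_{Y_v} [φ_v], where φ_v is the
-- conjunction of the clauses at the leaves below v and X_v, Y_v collect the labels of the X- and
-- Y-graded nodes below v.  At a node, the factors of the children merge because a projection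
-- commutes with multiplication by a nonnegative factor that does not depend on the projected
-- variable ("early projection"): by the scoping condition and injectivity of γ, a label below
-- one child occurs in no clause below a sibling.  Below a Y-node there are no X-labels, so the
-- random projections stay innermost.  At the root φ_r is a permutation of φ, and X_r, Y_r have
-- the same elements as X, Y; a sequence of projections depends only on the set of projected
-- variables, since projections commute and projecting a variable twice changes nothing.

module Submission where

open import Defs
open import Algebra.Properties.CommutativeSemigroup using (interchange)
import Algebra.Construct.Pointwise as Pointwise
open import Algebra.Bundles using (CommutativeMonoid)
open import Data.Bool using (Bool; true; false; not; _∨_)
open import Data.Empty using (⊥-elim)
open import Data.Fin using (Fin)
open import Data.List using (List; []; _∷_; _++_; map; foldr; lookup; length; allFin)
open import Data.List.Properties using (foldr-++; map-++; map-tabulate; tabulate-lookup)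
open import Data.List.Membership.Propositional using (_∈_; _∉_)
open import Data.List.Membership.Propositional.Properties using (∈-++⁺ˡ; ∈-++⁺ʳ; ∈-++⁻)
open import Data.List.Relation.Binary.Disjoint.Propositional using (Disjoint)
open import Data.List.Relation.Binary.Permutation.Propositional using (_↭_; ↭-sym; ↭⇒↭ₛ; ↭⇒↭ₛ′)
import Data.List.Relation.Binary.Permutation.Propositional.Properties as ↭
import Data.List.Relation.Binary.Permutation.Setoid.Properties as ↭ₛ
open import Data.List.Relation.Binary.Subset.Propositional using (_⊆_)
open import Data.List.Relation.Binary.Subset.Propositional.Properties using (++⁺)
import Data.List.Relation.Unary.All as All
import Data.List.Relation.Unary.All.Properties as All
open import Data.List.Relation.Unary.Any using (here; there)
open import Data.List.Relation.Unary.Unique.Propositional using (Unique; []; _∷_)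
open import Data.List.Relation.Unary.Unique.Propositional.Properties using (allFin⁺)
open import Data.Nat using (ℕ; _≟_)
open import Data.Product using (_×_; _,_; proj₁; proj₂; ∃-syntax; map₂; swap)
open import Data.Rational using (ℚ; 0ℚ; 1ℚ; _+_; _*_; _-_; _⊔_; _≤_; nonNegative)
import Data.Rational.Properties as ℚ
open import Data.Sum using (_⊎_; inj₁; inj₂; [_,_]′)
open import Data.Unit using (tt)
open import Function using (_∘_)
open import Function.Bundles using (Equivalence)
open import Level using (0ℓ)
open import Relation.Binary.PropositionalEquality as ≡
  using (_≡_; _≢_; _≗_; refl; sym; trans; cong; cong₂; cong-app; subst; module ≡-Reasoning)
open import Relation.Nullary using (yes; no; Dec; ¬_)
open import Relation.Nullary.Decidable using (dec⇒maybe)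
open import Relation.Unary using (Pred; U; _∩_)
open import Tactic.RingSolver using (solve-∀)
open import Tactic.RingSolver.Core.AlmostCommutativeRing
  using (AlmostCommutativeRing; fromCommutativeRing)

[↦]-≡ : ∀ τ {a y} b → y ≡ a → (τ [ a ↦ b ]) y ≡ b
[↦]-≡ τ {a} {y} b y≡a with y ≟ a
... | yes _   = refl
... | no y≢a = ⊥-elim (y≢a y≡a)

[↦]-≢ : ∀ τ {a y} b → y ≢ a → (τ [ a ↦ b ]) y ≡ τ y
[↦]-≢ τ {a} {y} b y≢a with y ≟ a
... | yes y≡a = ⊥-elim (y≢a y≡a)
... | no _    = refl

[↦]-comm : ∀ τ {a b} (i j : Bool) → a ≢ b → (τ [ a ↦ i ]) [ b ↦ j ] ≗ (τ [ b ↦ j ]) [ a ↦ i ]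
[↦]-comm τ {a} {b} i j a≢b y = byCases (y ≟ a) (y ≟ b)
  where
  -- `with y ≟ b` would also abstract the test hidden inside the inner update.
  byCases : Dec (y ≡ a) → Dec (y ≡ b) → ((τ [ a ↦ i ]) [ b ↦ j ]) y ≡ ((τ [ b ↦ j ]) [ a ↦ i ]) y
  byCases (yes y≡a) _ = trans ([↦]-≢ _ j (λ y≡b → a≢b (trans (sym y≡a) y≡b)))
                              (trans ([↦]-≡ τ i y≡a) (sym ([↦]-≡ _ i y≡a)))
  byCases (no y≢a) (yes y≡b) =
    trans ([↦]-≡ _ j y≡b) (sym (trans ([↦]-≢ _ i y≢a) ([↦]-≡ τ j y≡b)))
  byCases (no y≢a) (no y≢b) = trans ([↦]-≢ _ j y≢b) (trans ([↦]-≢ τ i y≢a)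
                                (sym (trans ([↦]-≢ _ i y≢a) ([↦]-≢ τ j y≢b))))

AgreeOn : Pred Var 0ℓ → Assignment → Assignment → Set
AgreeOn V τ τ′ = ∀ {y} → V y → τ y ≡ τ′ y

[↦]-agreeOn : ∀ {V τ τ′} a b → AgreeOn (V ∩ (_≢ a)) τ τ′ →
              AgreeOn V (τ [ a ↦ b ]) (τ′ [ a ↦ b ])
[↦]-agreeOn a b agree {y} v with y ≟ a
... | yes _   = refl
... | no y≢a = agree (v , y≢a)

Supported : Pred Var 0ℓ → PB → Set
Supported V f = ∀ τ τ′ → AgreeOn V τ τ′ → f τ ≡ f τ′

Extensional : PB → Set
Extensional = Supported U

supported-mono : ∀ {V W f} → (∀ {y} → V y → W y) → Supported V f → Supported W f
supported-mono V⊆W sf τ τ′ agree = sf τ τ′ (agree ∘ V⊆W)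

supported⇒extensional : ∀ {V f} → Supported V f → Extensional f
supported⇒extensional = supported-mono (λ _ → tt)

NonNeg : PB → Set
NonNeg f = ∀ τ → 0ℚ ≤ f τ

-- ∃₁ and R₁ are the instances G a = _⊔_ and G a u v = pr a * v + (1 - pr a) * u, and only the
-- three laws below are used.  For _⊔_ the last one needs 0 ≤ c, which is why nonnegativity of
-- all intermediate functions (hence pr y ∈ [0, 1]) has to be tracked.
module Projection
  (G : Var → ℚ → ℚ → ℚ)
  (G-idem : ∀ a u → G a u u ≡ u)
  (G-interchange : ∀ a b u v w z → G a (G b u v) (G b w z) ≡ G b (G a u w) (G a v z))
  (G-*-distribʳ : ∀ a u v c → 0ℚ ≤ c → G a (u * c) (v * c) ≡ G a u v * c)
  where

  P₁ : Var → PB → PB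
  P₁ a f τ = G a (f (τ [ a ↦ false ])) (f (τ [ a ↦ true ]))

  Pₛ : List Var → PB → PB
  Pₛ S f = foldr P₁ f S

  Pₛ-++ : ∀ S T f → Pₛ (S ++ T) f ≡ Pₛ S (Pₛ T f)
  Pₛ-++ S T f = foldr-++ P₁ f S T

  P₁-cong : ∀ a {f g} → f ≗ g → P₁ a f ≗ P₁ a g
  P₁-cong a f≗g τ = cong₂ (G a) (f≗g _) (f≗g _)

  Pₛ-cong : ∀ S {f g} → f ≗ g → Pₛ S f ≗ Pₛ S g
  Pₛ-cong []      f≗g = f≗g
  Pₛ-cong (a ∷ S) f≗g = P₁-cong a (Pₛ-cong S f≗g)

  P₁-supported : ∀ {V f} a → Supported V f → Supported (V ∩ (_≢ a)) (P₁ a f)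
  P₁-supported a sf τ τ′ agree =
    cong₂ (G a) (sf _ _ ([↦]-agreeOn a false agree)) (sf _ _ ([↦]-agreeOn a true agree))

  Pₛ-supported : ∀ {V f} S → Supported V f → Supported (V ∩ (_∉ S)) (Pₛ S f)
  Pₛ-supported []      sf τ τ′ agree = sf τ τ′ (λ v → agree (v , λ ()))
  Pₛ-supported (a ∷ S) sf τ τ′ agree = P₁-supported a (Pₛ-supported S sf) τ τ′
    λ ((v , y∉S) , y≢a) → agree (v , λ { (here y≡a) → y≢a y≡a ; (there y∈S) → y∉S y∈S })

  Pₛ-extensional : ∀ {f} S → Extensional f → Extensional (Pₛ S f)
  Pₛ-extensional S ext = supported⇒extensional (Pₛ-supported S ext)

  P₁-absorb : ∀ {f} a → Supported (_≢ a) f → P₁ a f ≗ f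
  P₁-absorb {f} a sf τ = begin
    G a (f (τ [ a ↦ false ])) (f (τ [ a ↦ true ]))  ≡⟨ cong₂ (G a) (unchanged false) (unchanged true) ⟩
    G a (f τ) (f τ)                                  ≡⟨ G-idem a (f τ) ⟩
    f τ                                              ∎
    where
    open ≡-Reasoning
    unchanged : ∀ b → f (τ [ a ↦ b ]) ≡ f τ
    unchanged b = sf _ _ ([↦]-≢ τ b)

  Pₛ-absorb : ∀ {T f} S → Supported (_∉ T) f → S ⊆ T → Pₛ S f ≗ f
  Pₛ-absorb []      sf S⊆T τ = refl
  Pₛ-absorb (a ∷ S) sf S⊆T τ = trans (P₁-cong a (Pₛ-absorb S sf (S⊆T ∘ there)) τ)
    (P₁-absorb a (supported-mono (λ { y∉T refl → y∉T (S⊆T (here refl)) }) sf) τ)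

  P₁-comm : ∀ {f} a b → Extensional f → P₁ a (P₁ b f) ≗ P₁ b (P₁ a f)
  P₁-comm {f} a b ext τ with a ≟ b
  ... | yes refl = refl
  ... | no a≢b  = trans (G-interchange a b _ _ _ _)
    (cong₂ (G b) (cong₂ (G a) (reorder false false) (reorder true false))
                 (cong₂ (G a) (reorder false true) (reorder true true)))
    where
    reorder : ∀ i j → f ((τ [ a ↦ i ]) [ b ↦ j ]) ≡ f ((τ [ b ↦ j ]) [ a ↦ i ])
    reorder i j = ext _ _ (λ {y} _ → [↦]-comm τ i j a≢b y)

  Pₛ-P₁-comm : ∀ {f} S b → Extensional f → Pₛ S (P₁ b f) ≗ P₁ b (Pₛ S f)
  Pₛ-P₁-comm []      b ext τ = refl
  Pₛ-P₁-comm (a ∷ S) b ext τ =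
    trans (P₁-cong a (Pₛ-P₁-comm S b ext) τ) (P₁-comm a b (Pₛ-extensional S ext) τ)

  Pₛ-comm : ∀ {f} S T → Extensional f → Pₛ S (Pₛ T f) ≗ Pₛ T (Pₛ S f)
  Pₛ-comm S []      ext τ = refl
  Pₛ-comm S (b ∷ T) ext τ =
    trans (Pₛ-P₁-comm S b (Pₛ-extensional T ext) τ) (P₁-cong b (Pₛ-comm S T ext) τ)

  Pₛ-sameElements : ∀ {f} S T → Extensional f → S ⊆ T → T ⊆ S → Pₛ S f ≗ Pₛ T f
  Pₛ-sameElements {f} S T ext S⊆T T⊆S τ = begin
    Pₛ S f τ          ≡⟨ Pₛ-absorb T (avoids S) T⊆S τ ⟨
    Pₛ T (Pₛ S f) τ   ≡⟨ Pₛ-comm T S ext τ ⟩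
    Pₛ S (Pₛ T f) τ   ≡⟨ Pₛ-absorb S (avoids T) S⊆T τ ⟩
    Pₛ T f τ          ∎
    where
    open ≡-Reasoning
    avoids : ∀ R → Supported (_∉ R) (Pₛ R f)
    avoids R = supported-mono proj₂ (Pₛ-supported R ext)

  Pₛ-pullʳ : ∀ {f g} S → Supported (_∉ S) g → NonNeg g → Pₛ S (f · g) ≗ Pₛ S f · g
  Pₛ-pullʳ         []      sg g≥0 τ = refl
  Pₛ-pullʳ {f} {g} (a ∷ S) sg g≥0 τ = begin
    G a (Pₛ S (f · g) τ₀) (Pₛ S (f · g) τ₁)
      ≡⟨ cong₂ (G a) (ih τ₀) (ih τ₁) ⟩
    G a (Pₛ S f τ₀ * g τ₀) (Pₛ S f τ₁ * g τ₁)
      ≡⟨ cong₂ (λ u v → G a (Pₛ S f τ₀ * u) (Pₛ S f τ₁ * v)) (unchanged false) (unchanged true) ⟩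
    G a (Pₛ S f τ₀ * g τ) (Pₛ S f τ₁ * g τ)
      ≡⟨ G-*-distribʳ a _ _ (g τ) (g≥0 τ) ⟩
    G a (Pₛ S f τ₀) (Pₛ S f τ₁) * g τ
      ∎
    where
    open ≡-Reasoning
    τ₀ τ₁ : Assignment
    τ₀ = τ [ a ↦ false ]
    τ₁ = τ [ a ↦ true ]
    ih : Pₛ S (f · g) ≗ Pₛ S f · g
    ih = Pₛ-pullʳ S (supported-mono (_∘ there) sg) g≥0
    unchanged : ∀ b → g (τ [ a ↦ b ]) ≡ g τ
    unchanged b = sg _ _ (λ y∉a∷S → [↦]-≢ τ b (y∉a∷S ∘ here))

  Pₛ-pullˡ : ∀ {f g} S → Supported (_∉ S) g → NonNeg g → Pₛ S (g · f) ≗ g · Pₛ S f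
  Pₛ-pullˡ {f} {g} S sg g≥0 τ =
    trans (Pₛ-cong S (λ σ → ℚ.*-comm (g σ) (f σ)) τ)
          (trans (Pₛ-pullʳ S sg g≥0 τ) (ℚ.*-comm (Pₛ S f τ) (g τ)))

  Pₛ-·-++ : ∀ {V W f g} S T → Supported V f → Supported W g →
            (∀ {x} → x ∈ T → ¬ V x) → (∀ {x} → x ∈ S → ¬ W x) →
            NonNeg f → NonNeg (Pₛ T g) → Pₛ S f · Pₛ T g ≗ Pₛ (S ++ T) (f · g)
  Pₛ-·-++ {f = f} {g} S T sf sg T∌V S∌W f≥0 Tg≥0 τ = begin
    Pₛ S f τ * Pₛ T g τ    ≡⟨ Pₛ-pullʳ S (avoiding S∌W (supported-mono proj₁ (Pₛ-supported T sg))) Tg≥0 τ ⟨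
    Pₛ S (f · Pₛ T g) τ    ≡⟨ Pₛ-cong S (Pₛ-pullˡ T (avoiding T∌V sf) f≥0) τ ⟨
    Pₛ S (Pₛ T (f · g)) τ  ≡⟨ cong-app (Pₛ-++ S T (f · g)) τ ⟨
    Pₛ (S ++ T) (f · g) τ  ∎
    where
    open ≡-Reasoning
    avoiding : ∀ {R Q h} → (∀ {x} → x ∈ R → ¬ Q x) → Supported Q h → Supported (_∉ R) h
    avoiding R∌Q = supported-mono (λ q x∈R → R∌Q x∈R q)

  Pₛ-nonNeg : ∀ {f} S → (∀ {a} → a ∈ S → ∀ {u v} → 0ℚ ≤ u → 0ℚ ≤ v → 0ℚ ≤ G a u v) →
              NonNeg f → NonNeg (Pₛ S f)
  Pₛ-nonNeg []      G≥0 f≥0 = f≥0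
  Pₛ-nonNeg (a ∷ S) G≥0 f≥0 τ =
    G≥0 (here refl) (Pₛ-nonNeg S (G≥0 ∘ there) f≥0 _) (Pₛ-nonNeg S (G≥0 ∘ there) f≥0 _)

ℚ-ring : AlmostCommutativeRing 0ℓ 0ℓ
ℚ-ring = fromCommutativeRing ℚ.+-*-commutativeRing (λ q → dec⇒maybe (0ℚ ℚ.≟ q))

convex-idem : ∀ p u → p * u + (1ℚ - p) * u ≡ u
convex-idem = solve-∀ ℚ-ring

convex-interchange : ∀ p q u v w z →
  p * (q * z + (1ℚ - q) * w) + (1ℚ - p) * (q * v + (1ℚ - q) * u) ≡
  q * (p * z + (1ℚ - p) * v) + (1ℚ - q) * (p * w + (1ℚ - p) * u)
convex-interchange = solve-∀ ℚ-ring

convex-*-distribʳ : ∀ p u v c → p * (v * c) + (1ℚ - p) * (u * c) ≡ (p * v + (1ℚ - p) * u) * c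
convex-*-distribʳ = solve-∀ ℚ-ring

*-nonNeg : ∀ {p q} → 0ℚ ≤ p → 0ℚ ≤ q → 0ℚ ≤ p * q
*-nonNeg {p} {q} 0≤p 0≤q =
  ℚ.nonNegative⁻¹ _ {{ℚ.nonNeg*nonNeg⇒nonNeg p {{nonNegative 0≤p}} q {{nonNegative 0≤q}}}}

convex-nonNeg : ∀ {p u v} → 0ℚ ≤ p → p ≤ 1ℚ → 0ℚ ≤ u → 0ℚ ≤ v → 0ℚ ≤ p * v + (1ℚ - p) * u
convex-nonNeg {p} 0≤p p≤1 0≤u 0≤v = ℚ.+-mono-≤ (*-nonNeg 0≤p 0≤v) (*-nonNeg 0≤1-p 0≤u)
  where
  0≤1-p : 0ℚ ≤ 1ℚ - p
  0≤1-p = subst (_≤ 1ℚ - p) (ℚ.+-inverseʳ 1ℚ) (ℚ.+-monoʳ-≤ 1ℚ (ℚ.neg-antimono-≤ p≤1))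

⊔-nonNeg : ∀ {u v} → 0ℚ ≤ u → 0ℚ ≤ v → 0ℚ ≤ u ⊔ v
⊔-nonNeg {u} {v} 0≤u _ = ℚ.≤-trans 0≤u (ℚ.p≤p⊔q u v)

module ∃ₚ = Projection (λ _ → _⊔_) (λ _ → ℚ.⊔-idem)
  (λ _ _ → interchange ℚ.⊔-commutativeSemigroup)
  (λ _ u v c 0≤c → sym (ℚ.*-distribʳ-⊔-nonNeg c {{nonNegative 0≤c}} u v))

module Rₚ (pr : Var → ℚ) = Projection (λ a u v → pr a * v + (1ℚ - pr a) * u)
  (λ a → convex-idem (pr a)) (λ a b → convex-interchange (pr a) (pr b))
  (λ a u v c _ → convex-*-distribʳ (pr a) u v c)

litSat-cong : ∀ {τ τ′} l → τ (proj₁ l) ≡ τ′ (proj₁ l) → litSat τ l ≡ litSat τ′ l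
litSat-cong (x , true)  eq = eq
litSat-cong (x , false) eq = cong not eq

clauseSat-cong : ∀ {τ τ′} c → AgreeOn (_∈ clauseVars c) τ τ′ → clauseSat τ c ≡ clauseSat τ′ c
clauseSat-cong []      agree = refl
clauseSat-cong (l ∷ c) agree =
  cong₂ _∨_ (litSat-cong l (agree (here refl))) (clauseSat-cong c (agree ∘ there))

⟦⟧ᶜ-supported : ∀ c → Supported (_∈ clauseVars c) ⟦ c ⟧ᶜ
⟦⟧ᶜ-supported c τ τ′ agree = cong ⟦_⟧𝔹 (clauseSat-cong c agree)

⟦⟧-supported : ∀ φ → Supported (_∈ vars φ) ⟦ φ ⟧
⟦⟧-supported []      τ τ′ agree = refl
⟦⟧-supported (c ∷ φ) τ τ′ agree =
  cong₂ _*_ (⟦⟧ᶜ-supported c τ τ′ (agree ∘ ∈-++⁺ˡ))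
            (⟦⟧-supported φ τ τ′ (agree ∘ ∈-++⁺ʳ (clauseVars c)))

⟦⟧𝔹-nonNeg : ∀ b → 0ℚ ≤ ⟦ b ⟧𝔹
⟦⟧𝔹-nonNeg true  = ℚ.nonNegative⁻¹ 1ℚ
⟦⟧𝔹-nonNeg false = ℚ.≤-refl

⟦⟧-nonNeg : ∀ φ → NonNeg ⟦ φ ⟧
⟦⟧-nonNeg []      τ = ℚ.nonNegative⁻¹ 1ℚ
⟦⟧-nonNeg (c ∷ φ) τ = *-nonNeg (⟦⟧𝔹-nonNeg (clauseSat τ c)) (⟦⟧-nonNeg φ τ)

⟦⟧-++ : ∀ φ ψ → ⟦ φ ++ ψ ⟧ ≗ ⟦ φ ⟧ · ⟦ ψ ⟧
⟦⟧-++ []      ψ τ = sym (ℚ.*-identityˡ _)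
⟦⟧-++ (c ∷ φ) ψ τ =
  trans (cong (⟦ c ⟧ᶜ τ *_) (⟦⟧-++ φ ψ τ)) (sym (ℚ.*-assoc (⟦ c ⟧ᶜ τ) (⟦ φ ⟧ τ) (⟦ ψ ⟧ τ)))

⟦⟧-↭ : ∀ {φ ψ} → φ ↭ ψ → ⟦ φ ⟧ ≗ ⟦ ψ ⟧
⟦⟧-↭ φ↭ψ =
  ↭ₛ.foldr-commMonoid setoid isCommutativeMonoid (↭⇒↭ₛ′ isEquivalence (↭.map⁺ ⟦_⟧ᶜ φ↭ψ))
  where open CommutativeMonoid (Pointwise.commutativeMonoid Assignment ℚ.*-1-commutativeMonoid)

Unique-++⁻ : ∀ {A : Set} (xs : List A) {ys} → Unique (xs ++ ys) →
             Unique xs × Unique ys × Disjoint xs ys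
Unique-++⁻ []       u         = [] , u , λ { (() , _) }
Unique-++⁻ (x ∷ xs) (x∉ ∷ u) with Unique-++⁻ xs u | All.++⁻ xs x∉
... | uxs , uys , xs#ys | x∉xs , x∉ys = x∉xs ∷ uxs , uys , λ
  { (here refl , x∈ys) → All.lookup x∉ys x∈ys refl
  ; (there v∈xs , v∈ys) → xs#ys (v∈xs , v∈ys) }

ownLabels : Grade → Grade → List Var → List Var
ownLabels gX gX xs = xs
ownLabels gX gY xs = []
ownLabels gY gX xs = []
ownLabels gY gY xs = xs

ownLabels⊆ : ∀ g g′ xs → ownLabels g g′ xs ⊆ xs
ownLabels⊆ gX gX xs x∈ = x∈
ownLabels⊆ gY gY xs x∈ = x∈
ownLabels⊆ gX gY xs ()
ownLabels⊆ gY gX xs ()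

⊆ownLabels : ∀ g xs → xs ⊆ ownLabels g g xs
⊆ownLabels gX xs x∈ = x∈
⊆ownLabels gY xs x∈ = x∈

module _ {m : ℕ} where

  labelsOf : Grade → Tree m → List Var
  labelsOfF : Grade → List (Tree m) → List Var
  labelsOf g (leaf _)        = []
  labelsOf g (node g′ xs ts) = ownLabels g g′ xs ++ labelsOfF g ts
  labelsOfF g []       = []
  labelsOfF g (t ∷ ts) = labelsOf g t ++ labelsOfF g ts

  labelsOf⊆labels : ∀ g t → labelsOf g t ⊆ labels t
  labelsOfF⊆labelsF : ∀ g ts → labelsOfF g ts ⊆ labelsF ts
  labelsOf⊆labels g (leaf _)        ()
  labelsOf⊆labels g (node g′ xs ts) = ++⁺ (ownLabels⊆ g g′ xs) (labelsOfF⊆labelsF g ts)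
  labelsOfF⊆labelsF g []       ()
  labelsOfF⊆labelsF g (t ∷ ts) = ++⁺ (labelsOf⊆labels g t) (labelsOfF⊆labelsF g ts)

  ∈-labels⇒∈-labelsOf : ∀ t {x} → x ∈ labels t → ∃[ g ] x ∈ labelsOf g t
  ∈-labelsF⇒∈-labelsOfF : ∀ ts {x} → x ∈ labelsF ts → ∃[ g ] x ∈ labelsOfF g ts
  ∈-labels⇒∈-labelsOf (node g xs ts) x∈ with ∈-++⁻ xs x∈
  ... | inj₁ x∈xs = g , ∈-++⁺ˡ (⊆ownLabels g xs x∈xs)
  ... | inj₂ x∈ts = map₂ (λ {g′} → ∈-++⁺ʳ (ownLabels g′ g xs)) (∈-labelsF⇒∈-labelsOfF ts x∈ts)
  ∈-labelsF⇒∈-labelsOfF (t ∷ ts) x∈ with ∈-++⁻ (labels t) x∈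
  ... | inj₁ x∈t  = map₂ ∈-++⁺ˡ (∈-labels⇒∈-labelsOf t x∈t)
  ... | inj₂ x∈ts = map₂ (λ {g} → ∈-++⁺ʳ (labelsOf g t)) (∈-labelsF⇒∈-labelsOfF ts x∈ts)

  OnlyY⇒X-labels≡[] : ∀ t → OnlyY t → labelsOf gX t ≡ []
  OnlyYF⇒X-labelsF≡[] : ∀ ts → OnlyYF ts → labelsOfF gX ts ≡ []
  OnlyY⇒X-labels≡[] (leaf _)       _     = refl
  OnlyY⇒X-labels≡[] (node gX _ _)  ()
  OnlyY⇒X-labels≡[] (node gY _ ts) onlyY = OnlyYF⇒X-labelsF≡[] ts onlyY
  OnlyYF⇒X-labelsF≡[] []       _                = refl
  OnlyYF⇒X-labelsF≡[] (t ∷ ts) (onlyY , onlyYs) =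
    cong₂ _++_ (OnlyY⇒X-labels≡[] t onlyY) (OnlyYF⇒X-labelsF≡[] ts onlyYs)

  module _ {X Y : List Var} where

    X-labels⊆X : ∀ t → Graded X Y t → labelsOf gX t ⊆ X
    X-labelsF⊆X : ∀ ts → GradedF X Y ts → labelsOfF gX ts ⊆ X
    X-labels⊆X (leaf _)        _                = λ ()
    X-labels⊆X (node gX xs ts) (xs⊆X , gr)      = [ xs⊆X _ , X-labelsF⊆X ts gr ]′ ∘ ∈-++⁻ xs
    X-labels⊆X (node gY xs ts) (_ , gr , _)     = X-labelsF⊆X ts gr
    X-labelsF⊆X []       _          = λ ()
    X-labelsF⊆X (t ∷ ts) (gr , grs) = [ X-labels⊆X t gr , X-labelsF⊆X ts grs ]′ ∘ ∈-++⁻ (labelsOf gX t)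

    Y-labels⊆Y : ∀ t → Graded X Y t → labelsOf gY t ⊆ Y
    Y-labelsF⊆Y : ∀ ts → GradedF X Y ts → labelsOfF gY ts ⊆ Y
    Y-labels⊆Y (leaf _)        _                = λ ()
    Y-labels⊆Y (node gX xs ts) (_ , gr)         = Y-labelsF⊆Y ts gr
    Y-labels⊆Y (node gY xs ts) (xs⊆Y , gr , _)  = [ xs⊆Y _ , Y-labelsF⊆Y ts gr ]′ ∘ ∈-++⁻ xs
    Y-labelsF⊆Y []       _          = λ ()
    Y-labelsF⊆Y (t ∷ ts) (gr , grs) = [ Y-labels⊆Y t gr , Y-labelsF⊆Y ts grs ]′ ∘ ∈-++⁻ (labelsOf gY t)

module _ {m : ℕ} (cl : Fin m → Clause) where

  subformula : Tree m → CNF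
  subformula t = map cl (leaves t)

  subformulaF : List (Tree m) → CNF
  subformulaF ts = map cl (leavesF ts)

  labels-scoped : ∀ t → Scoped cl t → ∀ {x i} → x ∈ labels t → x ∈ clauseVars (cl i) → i ∈ leaves t
  labelsF-scoped : ∀ ts → ScopedF cl ts → ∀ {x i} → x ∈ labelsF ts → x ∈ clauseVars (cl i) → i ∈ leavesF ts
  labels-scoped (node _ xs ts) (sc , scs) x∈ x∈c with ∈-++⁻ xs x∈
  ... | inj₁ x∈xs = sc _ _ x∈xs x∈c
  ... | inj₂ x∈ts = labelsF-scoped ts scs x∈ts x∈c
  labelsF-scoped (t ∷ ts) (sc , scs) x∈ x∈c with ∈-++⁻ (labels t) x∈
  ... | inj₁ x∈t  = ∈-++⁺ˡ (labels-scoped t sc x∈t x∈c)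
  ... | inj₂ x∈ts = ∈-++⁺ʳ (leaves t) (labelsF-scoped ts scs x∈ts x∈c)

  ∈-vars-map⁻ : ∀ is {x} → x ∈ vars (map cl is) → ∃[ i ] i ∈ is × x ∈ clauseVars (cl i)
  ∈-vars-map⁻ (i ∷ is) x∈ with ∈-++⁻ (clauseVars (cl i)) x∈
  ... | inj₁ x∈c  = i , here refl , x∈c
  ... | inj₂ x∈is = let j , j∈is , x∈c = ∈-vars-map⁻ is x∈is in j , there j∈is , x∈c

  scoped⇒∉vars : ∀ {L is js} → (∀ {x i} → x ∈ L → x ∈ clauseVars (cl i) → i ∈ is) →
                 Disjoint is js → ∀ {x} → x ∈ L → x ∉ vars (map cl js)
  scoped⇒∉vars scope is#js x∈L x∈js =
    let i , i∈js , x∈c = ∈-vars-map⁻ _ x∈js in is#js (scope x∈L x∈c , i∈js)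

module _ {m : ℕ} (cl : Fin m → Clause) (pr : Var → ℚ) {X Y : List Var}
         (pr∈[0,1] : ∀ y → y ∈ Y → (0ℚ ≤ pr y) × (pr y ≤ 1ℚ)) where

  Rₛ⟦⟧-supported : ∀ B φ → Supported (_∈ vars φ) (Rₛ pr B ⟦ φ ⟧)
  Rₛ⟦⟧-supported B φ = supported-mono proj₁ (Rₚ.Pₛ-supported pr B (⟦⟧-supported φ))

  Rₛ⟦⟧-nonNeg : ∀ {B} φ → B ⊆ Y → NonNeg (Rₛ pr B ⟦ φ ⟧)
  Rₛ⟦⟧-nonNeg {B} φ B⊆Y = Rₚ.Pₛ-nonNeg pr B convex≥0 (⟦⟧-nonNeg φ)
    where
    convex≥0 : ∀ {a} → a ∈ B → ∀ {u v} → 0ℚ ≤ u → 0ℚ ≤ v → 0ℚ ≤ pr a * v + (1ℚ - pr a) * u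
    convex≥0 a∈B = let 0≤p , p≤1 = pr∈[0,1] _ (B⊆Y a∈B) in convex-nonNeg 0≤p p≤1

  ∃ₛRₛ-·-++ : ∀ {A₁ B₁ A₂ B₂} φ₁ φ₂ → B₁ ⊆ Y → B₂ ⊆ Y →
              (∀ {x} → x ∈ A₁ → x ∉ vars φ₂) → (∀ {x} → x ∈ B₁ → x ∉ vars φ₂) →
              (∀ {x} → x ∈ A₂ → x ∉ vars φ₁) → (∀ {x} → x ∈ B₂ → x ∉ vars φ₁) →
              ∃ₛ A₁ (Rₛ pr B₁ ⟦ φ₁ ⟧) · ∃ₛ A₂ (Rₛ pr B₂ ⟦ φ₂ ⟧) ≗
              ∃ₛ (A₁ ++ A₂) (Rₛ pr (B₁ ++ B₂) ⟦ φ₁ ++ φ₂ ⟧)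
  ∃ₛRₛ-·-++ {A₁} {B₁} {A₂} {B₂} φ₁ φ₂ B₁⊆Y B₂⊆Y A₁∌ B₁∌ A₂∌ B₂∌ τ = begin
    ∃ₛ A₁ (Rₛ pr B₁ ⟦ φ₁ ⟧) τ * ∃ₛ A₂ (Rₛ pr B₂ ⟦ φ₂ ⟧) τ
      ≡⟨ ∃ₚ.Pₛ-·-++ A₁ A₂ (Rₛ⟦⟧-supported B₁ φ₁) (Rₛ⟦⟧-supported B₂ φ₂) A₂∌ A₁∌
                    (Rₛ⟦⟧-nonNeg φ₁ B₁⊆Y) (∃ₚ.Pₛ-nonNeg A₂ (λ _ → ⊔-nonNeg) (Rₛ⟦⟧-nonNeg φ₂ B₂⊆Y)) τ ⟩
    ∃ₛ (A₁ ++ A₂) (Rₛ pr B₁ ⟦ φ₁ ⟧ · Rₛ pr B₂ ⟦ φ₂ ⟧) τ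
      ≡⟨ ∃ₚ.Pₛ-cong (A₁ ++ A₂) (Rₚ.Pₛ-·-++ pr B₁ B₂ (⟦⟧-supported φ₁) (⟦⟧-supported φ₂) B₂∌ B₁∌
                                           (⟦⟧-nonNeg φ₁) (Rₛ⟦⟧-nonNeg φ₂ B₂⊆Y)) τ ⟩
    ∃ₛ (A₁ ++ A₂) (Rₛ pr (B₁ ++ B₂) (⟦ φ₁ ⟧ · ⟦ φ₂ ⟧)) τ
      ≡⟨ ∃ₚ.Pₛ-cong (A₁ ++ A₂) (Rₚ.Pₛ-cong pr (B₁ ++ B₂) (⟦⟧-++ φ₁ φ₂)) τ ⟨
    ∃ₛ (A₁ ++ A₂) (Rₛ pr (B₁ ++ B₂) ⟦ φ₁ ++ φ₂ ⟧) τ ∎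
    where open ≡-Reasoning

  val≗∃ₛRₛ : ∀ t → Scoped cl t → Unique (leaves t) → Graded X Y t →
             val cl pr t ≗ ∃ₛ (labelsOf gX t) (Rₛ pr (labelsOf gY t) ⟦ subformula cl t ⟧)
  valF≗∃ₛRₛ : ∀ ts → ScopedF cl ts → Unique (leavesF ts) → GradedF X Y ts →
              valF cl pr ts ≗ ∃ₛ (labelsOfF gX ts) (Rₛ pr (labelsOfF gY ts) ⟦ subformulaF cl ts ⟧)
  val≗∃ₛRₛ (leaf i) _ _ _ τ = sym (ℚ.*-identityʳ _)
  val≗∃ₛRₛ (node gX xs ts) (_ , scs) u (_ , gr) τ =
    trans (∃ₚ.Pₛ-cong xs (valF≗∃ₛRₛ ts scs u gr) τ)
          (cong-app (sym (∃ₚ.Pₛ-++ xs (labelsOfF gX ts) _)) τ)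
  val≗∃ₛRₛ (node gY xs ts) (_ , scs) u (_ , gr , onlyY) τ = begin
    Rₛ pr xs (valF cl pr ts) τ         ≡⟨ Rₚ.Pₛ-cong pr xs (valF≗∃ₛRₛ ts scs u gr) τ ⟩
    Rₛ pr xs (∃ₛ A (Rₛ pr B ⟦ φ ⟧)) τ   ≡⟨ cong (λ A → Rₛ pr xs (∃ₛ A (Rₛ pr B ⟦ φ ⟧)) τ) no-X-labels ⟩
    Rₛ pr xs (Rₛ pr B ⟦ φ ⟧) τ         ≡⟨ cong-app (Rₚ.Pₛ-++ pr xs B ⟦ φ ⟧) τ ⟨
    Rₛ pr (xs ++ B) ⟦ φ ⟧ τ            ≡⟨ cong (λ A → ∃ₛ A (Rₛ pr (xs ++ B) ⟦ φ ⟧) τ) no-X-labels ⟨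
    ∃ₛ A (Rₛ pr (xs ++ B) ⟦ φ ⟧) τ     ∎
    where
    open ≡-Reasoning
    A B : List Var
    A = labelsOfF gX ts
    B = labelsOfF gY ts
    φ : CNF
    φ = subformulaF cl ts
    no-X-labels : A ≡ []
    no-X-labels = OnlyYF⇒X-labelsF≡[] ts onlyY
  valF≗∃ₛRₛ []       _          _ _          τ = refl
  valF≗∃ₛRₛ (t ∷ ts) (sc , scs) u (gr , grs) τ with Unique-++⁻ (leaves t) u
  ... | ut , uts , t#ts = begin
    val cl pr t τ * valF cl pr ts τ
      ≡⟨ cong₂ _*_ (val≗∃ₛRₛ t sc ut gr τ) (valF≗∃ₛRₛ ts scs uts grs τ) ⟩
    ∃ₛ A₁ (Rₛ pr B₁ ⟦ φ₁ ⟧) τ * ∃ₛ A₂ (Rₛ pr B₂ ⟦ φ₂ ⟧) τ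
      ≡⟨ ∃ₛRₛ-·-++ φ₁ φ₂ (Y-labels⊆Y t gr) (Y-labelsF⊆Y ts grs)
                   (φ₂∌ ∘ labelsOf⊆labels gX t) (φ₂∌ ∘ labelsOf⊆labels gY t)
                   (φ₁∌ ∘ labelsOfF⊆labelsF gX ts) (φ₁∌ ∘ labelsOfF⊆labelsF gY ts) τ ⟩
    ∃ₛ (A₁ ++ A₂) (Rₛ pr (B₁ ++ B₂) ⟦ φ₁ ++ φ₂ ⟧) τ
      ≡⟨ cong (λ φ → ∃ₛ (A₁ ++ A₂) (Rₛ pr (B₁ ++ B₂) ⟦ φ ⟧) τ) (map-++ cl (leaves t) (leavesF ts)) ⟨
    ∃ₛ (A₁ ++ A₂) (Rₛ pr (B₁ ++ B₂) ⟦ subformulaF cl (t ∷ ts) ⟧) τ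
      ∎
    where
    open ≡-Reasoning
    A₁ B₁ A₂ B₂ : List Var
    A₁ = labelsOf gX t
    B₁ = labelsOf gY t
    A₂ = labelsOfF gX ts
    B₂ = labelsOfF gY ts
    φ₁ φ₂ : CNF
    φ₁ = subformula cl t
    φ₂ = subformulaF cl ts
    φ₁∌ : ∀ {x} → x ∈ labelsF ts → x ∉ vars φ₁
    φ₁∌ = scoped⇒∉vars cl (labelsF-scoped cl ts scs) (t#ts ∘ swap)
    φ₂∌ : ∀ {x} → x ∈ labels t → x ∉ vars φ₂
    φ₂∌ = scoped⇒∉vars cl (labels-scoped cl t sc) t#ts

⟦map-lookup⟧≗⟦⟧ : ∀ φ {is} → is ↭ allFin (length φ) → ⟦ map (lookup φ) is ⟧ ≗ ⟦ φ ⟧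
⟦map-lookup⟧≗⟦⟧ φ is↭ σ =
  trans (⟦⟧-↭ (↭.map⁺ (lookup φ) is↭) σ) (cong (λ ψ → ⟦ ψ ⟧ σ) map-lookup-allFin)
  where
  map-lookup-allFin : map (lookup φ) (allFin (length φ)) ≡ φ
  map-lookup-allFin = trans (map-tabulate (λ i → i) (lookup φ)) (tabulate-lookup φ)

module _ {φ X Y} {t : Tree (length φ)}
         (part : IsPartition φ X Y) (pj : IsPJTree φ t) (gr : Graded X Y t) where
  open IsPartition part
  open IsPJTree pj

  ∈-labelsOf : ∀ {x} → x ∈ X ⊎ x ∈ Y → ∃[ g ] x ∈ labelsOf g t
  ∈-labelsOf x∈X⊎Y =
    ∈-labels⇒∈-labelsOf t (Equivalence.from (π-covers _) (Equivalence.to (covers _) x∈X⊎Y))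

  X⊆X-labels : X ⊆ labelsOf gX t
  X⊆X-labels {x} x∈X with ∈-labelsOf (inj₁ x∈X)
  ... | gX , x∈A = x∈A
  ... | gY , x∈B = ⊥-elim (disjoint x x∈X (Y-labels⊆Y t gr x∈B))

  Y⊆Y-labels : Y ⊆ labelsOf gY t
  Y⊆Y-labels {y} y∈Y with ∈-labelsOf (inj₂ y∈Y)
  ... | gX , y∈A = ⊥-elim (disjoint y (X-labels⊆X t gr y∈A) y∈Y)
  ... | gY , y∈B = y∈B

theorem1 : (φ : CNF) (X Y : List Var) → IsPartition φ X Y →
           (t : Tree (length φ)) → IsPJTree φ t → Graded X Y t →
           (pr : Var → ℚ) → (∀ y → y ∈ Y → (0ℚ ≤ pr y) × (pr y ≤ 1ℚ)) →
           val (lookup φ) pr t ∅ ≡ ∃ₛ X (Rₛ pr Y ⟦ φ ⟧) ∅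
theorem1 φ X Y part t pj gr pr pr∈[0,1] = begin
  val (lookup φ) pr t ∅
    ≡⟨ val≗∃ₛRₛ (lookup φ) pr pr∈[0,1] t scoped leaves-unique gr ∅ ⟩
  ∃ₛ A (Rₛ pr B ⟦ subformula (lookup φ) t ⟧) ∅
    ≡⟨ ∃ₚ.Pₛ-cong A (Rₚ.Pₛ-cong pr B (⟦map-lookup⟧≗⟦⟧ φ γ-bij)) ∅ ⟩
  ∃ₛ A (Rₛ pr B ⟦ φ ⟧) ∅
    ≡⟨ ∃ₚ.Pₛ-cong A (Rₚ.Pₛ-sameElements pr B Y ⟦φ⟧-ext (Y-labels⊆Y t gr) (Y⊆Y-labels part pj gr)) ∅ ⟩
  ∃ₛ A (Rₛ pr Y ⟦ φ ⟧) ∅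
    ≡⟨ ∃ₚ.Pₛ-sameElements A X (Rₚ.Pₛ-extensional pr Y ⟦φ⟧-ext) (X-labels⊆X t gr) (X⊆X-labels part pj gr) ∅ ⟩
  ∃ₛ X (Rₛ pr Y ⟦ φ ⟧) ∅
    ∎
  where
  open ≡-Reasoning
  open IsPJTree pj
  A B : List Var
  A = labelsOf gX t
  B = labelsOf gY t
  ⟦φ⟧-ext : Extensional ⟦ φ ⟧
  ⟦φ⟧-ext = supported⇒extensional (⟦⟧-supported φ)
  leaves-unique : Unique (leaves t)
  leaves-unique = ↭ₛ.Unique-resp-↭ (≡.setoid _) (↭⇒↭ₛ (↭-sym γ-bij)) (allFin⁺ (length φ))
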